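{- Let $G=(V,E)$ be a digraph and $K,Z\subseteq V$ be such that $K$ is $Z$-normal. Let $\mathfrak{p}=(V_{\mathfrak{p}},E_{\mathfrak{p}})$ be a path in $G$ that is internally disjoint from $Z$. Then $|E_{\mathfrak{p}}\cap E(K,V\setminus K)|\le 2$.
   Context: For disjoint $Z,K\subseteq V$, $K$ is $Z$-normal if there is no directed walk in $V\setminus Z$ with first and last vertex in $K$ that uses a vertex of $V\setminus(Z\cup K)$. A path is a directed simple path $v_1e_1v_2\dots e_{n-1}v_n$ ($e_i$ has source $v_i$ and target $v_{i+1}$, vertices pairwise distinct), with vertex set $V_{\mathfrak{p}}$ and edge set $E_{\mathfrak{p}}$; it is internally disjoint from $Z$ if $Z\cap V_{\mathfrak{p}}\subseteq\{v_1,v_n\}$. For disjoint $V_1,V_2$, $E(V_1,V_2)$ is the set of edges with one endpoint in $V_1$ and the other in $V_2$. -}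

module Defs where

open import Data.Nat using (ℕ)
open import Data.Fin using (Fin)
open import Data.Fin.Subset using (Subset; _∈_; _∉_)
open import Data.Fin.Subset.Properties using (_∈?_)
open import Data.Bool using (Bool; _xor_)
open import Data.List using (List; []; _∷_; length; filterᵇ)
open import Data.List.Relation.Unary.All using (All)
open import Data.List.Relation.Unary.Any using (Any)
open import Data.List.Relation.Unary.Unique.Propositional using (Unique)
open import Data.Product using (_×_)
open import Data.Sum using (_⊎_)
open import Relation.Nullary using (¬_)
open import Relation.Nullary.Decidable using (isYes)
open import Relation.Binary.PropositionalEquality using (_≡_)

record Digraph : Set where
  field
    nV  : ℕ
    nE  : ℕ
    src : Fin nE → Fin nV
    tgt : Fin nE → Fin nV

module _ (G : Digraph) where
  open Digraph G

  data Walk : Fin nV → Fin nV → Set where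
    [_]  : (v : Fin nV) → Walk v v
    _◂_  : ∀ {w} (e : Fin nE) → Walk (tgt e) w → Walk (src e) w

  vertices : ∀ {u w} → Walk u w → List (Fin nV)
  vertices [ v ] = v ∷ []
  vertices (_◂_ {w} e W) = src e ∷ vertices W

  edges : ∀ {u w} → Walk u w → List (Fin nE)
  edges [ v ] = []
  edges (e ◂ W) = e ∷ edges W

  IsPath : ∀ {u w} → Walk u w → Set
  IsPath W = Unique (vertices W)

  ZNormal : Subset nV → Subset nV → Set
  ZNormal Z K =
    (∀ x → x ∈ Z → x ∉ K) ×
    (∀ {u w} (W : Walk u w) → u ∈ K → w ∈ K →
       All (λ x → x ∉ Z) (vertices W) →
       ¬ Any (λ x → x ∉ Z × x ∉ K) (vertices W))

  InternallyDisjoint : ∀ {u w} → Subset nV → Walk u w → Set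
  InternallyDisjoint {u} {w} Z W =
    All (λ x → x ∈ Z → x ≡ u ⊎ x ≡ w) (vertices W)

  -- e ∈ E(K, V∖K): exactly one endpoint of e lies in K.
  crosses : Subset nV → Fin nE → Bool
  crosses K e = isYes (src e ∈? K) xor isYes (tgt e ∈? K)

  -- |E_p ∩ E(K, V∖K)| (edges of a path are pairwise distinct).
  crossingCount : ∀ {u w} → Subset nV → Walk u w → ℕ
  crossingCount K W = length (filterᵇ (crosses K) (edges W))

-- Once a walk whose interior avoids Z has left K, it can never come back:
-- the walk from the last vertex of K before the exit to the first vertex of K
-- after it would stay in V ∖ Z, start and end in K, and visit the vertex just
-- outside K, contradicting Z-normality.  Hence the crossings of K are at most
-- one entry followed by one exit.
module Submission where

open import Defs
open import Data.Nat using (_≤_; z≤n; s≤s)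
open import Data.Nat.Properties using (≤-reflexive; m≤n⇒m≤1+n)
open import Data.Fin using (Fin)
open import Data.Fin.Subset using (Subset; _∈_; _∉_)
open import Data.Fin.Subset.Properties using (_∈?_)
open import Data.Unit using (⊤; tt)
open import Data.Empty using (⊥)
open import Data.Product using (_×_; _,_; proj₁; proj₂)
open import Data.Sum using (_⊎_; inj₁; inj₂)
open import Data.List.Relation.Unary.All as All using (All; []; _∷_)
open import Data.List.Relation.Unary.AllPairs using (_∷_)
open import Data.List.Membership.Propositional using (lose) renaming (_∈_ to _∈ₗ_)
open import Data.List.Relation.Unary.Any using (here; there)
open import Relation.Nullary using (yes; no; contradiction)
open import Relation.Binary.PropositionalEquality using (_≡_; _≢_; refl; sym)

module _ (G : Digraph) where
  open Digraph G

  AllButLast : (Fin nV → Set) → ∀ {a b} → Walk G a b → Set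
  AllButLast P [ v ]   = ⊤
  AllButLast P (e ◂ W) = P (src e) × AllButLast P W

  AllInterior : (Fin nV → Set) → ∀ {a b} → Walk G a b → Set
  AllInterior P [ v ]   = ⊤
  AllInterior P (e ◂ W) = AllButLast P W

  allInterior⇒allButLast : ∀ {P a b} (W : Walk G a b) → P a → AllInterior P W → AllButLast P W
  allInterior⇒allButLast [ v ]   _  _   = tt
  allInterior⇒allButLast (e ◂ W) pa int = pa , int

  allButLast⇒allInterior : ∀ {P a b} (W : Walk G a b) → AllButLast P W → AllInterior P W
  allButLast⇒allInterior [ v ]   _          = tt
  allButLast⇒allInterior (e ◂ W) (_ , rest) = rest

  all⇒allButLast : ∀ {P a b} (W : Walk G a b) → All P (vertices G W) → AllButLast P W
  all⇒allButLast [ v ]   _         = tt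
  all⇒allButLast (e ◂ W) (pa ∷ ps) = pa , all⇒allButLast W ps

  allButLast-zipWith : ∀ {P Q R : Fin nV → Set} → (∀ {x} → P x → Q x → R x) →
                       ∀ {a b} (W : Walk G a b) → AllButLast P W → AllButLast Q W → AllButLast R W
  allButLast-zipWith f [ v ]   _        _        = tt
  allButLast-zipWith f (e ◂ W) (p , ps) (q , qs) = f p q , allButLast-zipWith f W ps qs

  start∈vertices : ∀ {a b} (W : Walk G a b) → a ∈ₗ vertices G W
  start∈vertices [ v ]   = here refl
  start∈vertices (e ◂ W) = here refl

  end∈vertices : ∀ {a b} (W : Walk G a b) → b ∈ₗ vertices G W
  end∈vertices [ v ]   = here refl
  end∈vertices (e ◂ W) = there (end∈vertices W)

  path⇒allButLast≢end : ∀ {a b} (W : Walk G a b) → IsPath G W → AllButLast (_≢ b) W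
  path⇒allButLast≢end [ v ]   _            = tt
  path⇒allButLast≢end (e ◂ W) (a∉W ∷ path) = All.lookup a∉W (end∈vertices W) , path⇒allButLast≢end W path

  internallyDisjoint⇒allInterior∉ : ∀ {Z a b} (W : Walk G a b) → IsPath G W →
                                     InternallyDisjoint G Z W → AllInterior (_∉ Z) W
  internallyDisjoint⇒allInterior∉ [ v ] _ _ = tt
  internallyDisjoint⇒allInterior∉ {Z} {a} {b} (e ◂ W) (a∉W ∷ path) (_ ∷ disjoint) =
    allButLast-zipWith avoid W (all⇒allButLast W (All.zip (disjoint , a∉W))) (path⇒allButLast≢end W path)
    where
    avoid : ∀ {x} → (x ∈ Z → x ≡ a ⊎ x ≡ b) × a ≢ x → x ≢ b → x ∉ Z
    avoid (endpoint , a≢x) x≢b x∈Z with endpoint x∈Z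
    ... | inj₁ x≡a = a≢x (sym x≡a)
    ... | inj₂ x≡b = x≢b x≡b

module _ (G : Digraph) (Z K : Subset (Digraph.nV G)) (normal : ZNormal G Z K) where
  open Digraph G

  ∈K⇒∉Z : ∀ {x} → x ∈ K → x ∉ Z
  ∈K⇒∉Z x∈K x∈Z = proj₁ normal _ x∈Z x∈K

  record ReachesK (c : Fin nV) : Set where
    constructor reaches
    field
      {end}  : Fin nV
      walk   : Walk G c end
      end∈K  : end ∈ K
      avoidZ : All (_∉ Z) (vertices G walk)

  noCrossing⊎reachesK : ∀ {c b} (W : Walk G c b) → c ∉ K → AllButLast G (_∉ Z) W →
                        crossingCount G K W ≡ 0 ⊎ ReachesK c
  noCrossing⊎reachesK [ v ] _ _ = inj₁ refl
  noCrossing⊎reachesK (e ◂ W) c∉K (c∉Z , rest) with src e ∈? K | tgt e ∈? K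
  ... | yes c∈K | _       = contradiction c∈K c∉K
  ... | no _    | yes d∈K = inj₂ (reaches (e ◂ [ tgt e ]) d∈K (c∉Z ∷ ∈K⇒∉Z d∈K ∷ []))
  ... | no _    | no d∉K with noCrossing⊎reachesK W d∉K rest
  ...   | inj₁ none                  = inj₁ none
  ...   | inj₂ (reaches Q end∈K Q∉Z) = inj₂ (reaches (e ◂ Q) end∈K (c∉Z ∷ Q∉Z))

  noReturnToK : ∀ e → src e ∈ K → src e ∉ Z → tgt e ∉ K → ReachesK (tgt e) → ⊥
  noReturnToK e a∈K a∉Z c∉K (reaches Q end∈K Q∉Z) =
    proj₂ normal (e ◂ Q) a∈K end∈K (a∉Z ∷ Q∉Z)
      (there (lose (start∈vertices G Q) (All.lookup Q∉Z (start∈vertices G Q) , c∉K)))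

  crossingCount-fromK≤1 : ∀ {a b} (W : Walk G a b) → a ∈ K → AllButLast G (_∉ Z) W →
                          crossingCount G K W ≤ 1
  crossingCount-fromK≤1 [ v ] _ _ = z≤n
  crossingCount-fromK≤1 (e ◂ W) a∈K (a∉Z , rest) with src e ∈? K | tgt e ∈? K
  ... | no a∉K | _       = contradiction a∈K a∉K
  ... | yes _  | yes c∈K = crossingCount-fromK≤1 W c∈K rest
  ... | yes _  | no c∉K with noCrossing⊎reachesK W c∉K rest
  ...   | inj₁ none = s≤s (≤-reflexive none)
  ...   | inj₂ back = contradiction back (noReturnToK e a∈K a∉Z c∉K)

  crossingCount-outsideK≤2 : ∀ {a b} (W : Walk G a b) → a ∉ K → AllInterior G (_∉ Z) W →
                             crossingCount G K W ≤ 2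
  crossingCount-outsideK≤2 [ v ] _ _ = z≤n
  crossingCount-outsideK≤2 (e ◂ W) a∉K rest with src e ∈? K | tgt e ∈? K
  ... | yes a∈K | _       = contradiction a∈K a∉K
  ... | no _    | yes c∈K = s≤s (crossingCount-fromK≤1 W c∈K rest)
  ... | no _    | no c∉K  = crossingCount-outsideK≤2 W c∉K (allButLast⇒allInterior G W rest)

  crossingCount≤2 : ∀ {a b} (W : Walk G a b) → AllInterior G (_∉ Z) W → crossingCount G K W ≤ 2
  crossingCount≤2 {a} W interior with a ∈? K
  ... | yes a∈K = m≤n⇒m≤1+n (crossingCount-fromK≤1 W a∈K (allInterior⇒allButLast G W (∈K⇒∉Z a∈K) interior))
  ... | no a∉K  = crossingCount-outsideK≤2 W a∉K interior

proposition2 : (G : Digraph) (Z K : Subset (Digraph.nV G)) →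
    ZNormal G Z K →
    ∀ {u w : Fin (Digraph.nV G)} (p : Walk G u w) →
    IsPath G p →
    InternallyDisjoint G Z p →
    crossingCount G K p ≤ 2
proposition2 G Z K normal p path disjoint =
  crossingCount≤2 G Z K normal p (internallyDisjoint⇒allInterior∉ G p path disjoint)
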